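{- For a nonnegative integer $x$, let $P_n^{x}$ denote the path on $n$ vertices on which $x$ chips are placed, each chip independently and uniformly at random on one of the $n$ vertices (the weight of a vertex being its number of chips), and let $A_t(P_n^x)$ be its total acquisition number. Let $\phi$ be any function with $\phi(n)\to\infty$. Then for every $n$ and every nonnegative integer $x\in[n-\phi(n)\sqrt n,\, n+\phi(n)\sqrt n]$, $$E\big(A_t(P_n^{n})\big) - \phi(n)\sqrt n \le E\big(A_t(P_n^{x})\big) \le E\big(A_t(P_n^{n})\big) + \phi(n)\sqrt n.$$
   Context: Let $G$ be a graph whose vertices carry nonnegative integer weights $w(v)$. An acquisition move consists of choosing adjacent vertices $u,v$ with current weights satisfying $w(u)\ge w(v)>0$ and transferring all of the weight of $v$ to $u$. A sequence of acquisition moves after which no further move is possible is an acquisition protocol; the set of vertices with nonzero weight at its end is the residual set. The total acquisition number $a_t(G)$ is the minimum size of a residual set over all acquisition protocols.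
   Formalization: The function φ with φ(n)→∞ takes values in the rationals. -}

module Defs where

open import Data.Nat using (ℕ; zero; suc; _+_; _^_; _≤_; _<_; NonZero; _<?_)
open import Data.Nat.Properties using (m^n≢0)
open import Data.Fin using (Fin; toℕ; _≟_)
open import Data.Vec as Vec using (Vec; []; _∷_; count)
open import Data.List as List using (List; []; _∷_; concatMap; map)
open import Data.Nat.ListAction using (sum)
open import Data.Product using (∃; _×_)
open import Data.Sum using (_⊎_)
open import Data.Integer using (+_)
open import Data.Rational using (ℚ; _/_)
open import Relation.Nullary using (does)
open import Relation.Binary.PropositionalEquality using (_≡_)
open import Data.Bool using (if_then_else_)

Adj : ∀ {n} → Fin n → Fin n → Set
Adj u v = (suc (toℕ u) ≡ toℕ v) ⊎ (suc (toℕ v) ≡ toℕ u)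

Weight : ℕ → Set
Weight n = Fin n → ℕ

transfer : ∀ {n} → Weight n → Fin n → Fin n → Weight n
transfer w u v z =
  if does (z ≟ u) then w u + w v
  else (if does (z ≟ v) then 0 else w z)

Legal : ∀ {n} → Weight n → Fin n → Fin n → Set
Legal w u v = Adj u v × w v ≤ w u × 0 < w v

data Reach {n : ℕ} : Weight n → Weight n → Set where
  stop : ∀ {w} → Reach w w
  move : ∀ {w w'} (u v : Fin n) → Legal w u v → Reach (transfer w u v) w' → Reach w w'

Terminal : ∀ {n} → Weight n → Set
Terminal w = ∀ u v → Adj u v → w v ≤ w u → w v ≡ 0

residual : ∀ {n} → Weight n → ℕ
residual {n} w = count (λ v → 0 <? w v) (Vec.allFin n)

IsTotalAcq : ∀ {n} → Weight n → ℕ → Set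
IsTotalAcq w k =
  (∃ λ w' → Reach w w' × Terminal w' × residual w' ≡ k) ×
  (∀ w' → Reach w w' → Terminal w' → k ≤ residual w')

-- The sample space is all placements Fin x → Fin n
-- (enumerated as vectors), each with probability 1 / n^x.

placements : (n x : ℕ) → List (Vec (Fin n) x)
placements n zero = [] ∷ []
placements n (suc x) =
  concatMap (λ p → map (λ i → i ∷ p) (List.allFin n)) (placements n x)

chipWeight : ∀ {n x} → Vec (Fin n) x → Weight n
chipWeight p v = count (λ c → c ≟ v) p

E : (n x : ℕ) .{{_ : NonZero n}} → (Weight n → ℕ) → ℚ
E n x f = (+ sum (map (λ p → f (chipWeight p)) (placements n x))) / (n ^ x)
  where instance _ = m^n≢0 n x

-- Adding or removing one chip changes the total acquisition number of a weighted path by at most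
-- one. Averaging over the position of the last chip, the expectations for x + 1 and for x chips
-- therefore differ by at most 1, so |E(A_t(P_n^x)) − E(A_t(P_n^n))| ≤ |x − n| ≤ φ(n)√n.
--
-- The one-chip bound rests on a description of what acquisition moves can reach on a path. Cut the
-- path into consecutive parts, each an empty vertex or a block: a root flanked by a left arm, each of
-- whose entries is at least the total of the entries before it in the arm, and a mirror-image right
-- arm, the root being able to absorb the two arms one after the other. Every block collapses onto its
-- root, and every configuration reachable by acquisition moves is the collapse of such a
-- decomposition, with one occupied vertex per block. Changing one weight by one turns the part
-- containing it into at most two blocks, so some configuration reachable from the new weighting has
-- at most one occupied vertex more; further moves never increase the number of occupied vertices.

module Submission where

open import Defs

module PathAcquisition where

  open import Data.Nat using (ℕ; zero; suc; _+_; _≤_; _<_; z≤n; s≤s; _≤?_; _<?_)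
  open import Data.Nat.Properties hiding (_≟_)
  open import Data.Fin using (Fin; zero; suc; toℕ; _≟_)
  open import Data.Vec as Vec using (Vec; _∷_)
  open import Data.List using (List; []; _∷_; _++_; [_]; _∷ʳ_; length; replicate; map; concatMap; tabulate; initLast; _∷ʳ′_)
  open import Data.List.Properties using (++-assoc; ++-identityʳ; ∷-injective; concatMap-++; map-++; tabulate-cong)
  open import Data.List.Relation.Unary.All using (All; []; _∷_)
  import Data.List.Relation.Unary.All.Properties as All
  open import Data.Nat.ListAction using (sum)
  open import Data.Nat.ListAction.Properties using (sum-++)
  open import Data.Product using (∃; ∃₂; _×_; _,_; proj₁; proj₂)
  open import Data.Sum using (_⊎_; inj₁; inj₂; map₁; map₂) renaming (map to ⊎-map)
  open import Data.Unit using (⊤; tt)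
  open import Data.Empty using (⊥-elim)
  open import Relation.Nullary using (yes; no)
  open import Relation.Binary.PropositionalEquality
    using (_≡_; _≢_; refl; sym; trans; cong; cong₂; subst; subst₂; module ≡-Reasoning)
  open import Function using (_∘_; id)

  data Merge : ℕ → ℕ → ℕ → ℕ → Set where
    mergeˡ : ∀ {x y} → y ≤ x → 0 < y → Merge x y (x + y) 0
    mergeʳ : ∀ {x y} → x ≤ y → 0 < x → Merge x y 0 (y + x)

  infix 4 _⇝_

  -- A step carries its position as an equation, so that steps out of any list can be matched on.
  data _⇝_ : List ℕ → List ℕ → Set where
    done : ∀ {L} → L ⇝ L
    step : ∀ {L T} X {x y x′ y′} Y → L ≡ X ++ x ∷ y ∷ Y → Merge x y x′ y′ →
           X ++ x′ ∷ y′ ∷ Y ⇝ T → L ⇝ T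

  ⇝-trans : ∀ {L M T} → L ⇝ M → M ⇝ T → L ⇝ T
  ⇝-trans done r = r
  ⇝-trans (step X Y e m r) r′ = step X Y e m (⇝-trans r r′)

  ⇝-++ˡ : ∀ P {Q Q′} → Q ⇝ Q′ → P ++ Q ⇝ P ++ Q′
  ⇝-++ˡ P done = done
  ⇝-++ˡ P (step X Y refl m r) =
    step (P ++ X) Y (sym (++-assoc P X _)) m (subst (_⇝ _) (sym (++-assoc P X _)) (⇝-++ˡ P r))

  occupied : List ℕ → ℕ
  occupied []           = 0
  occupied (zero  ∷ xs) = occupied xs
  occupied (suc _ ∷ xs) = suc (occupied xs)

  occupied-++ : ∀ P Q → occupied (P ++ Q) ≡ occupied P + occupied Q
  occupied-++ []          Q = refl
  occupied-++ (zero  ∷ P) Q = occupied-++ P Q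
  occupied-++ (suc _ ∷ P) Q = cong suc (occupied-++ P Q)

  occupied-replicate-0 : ∀ m → occupied (replicate m 0) ≡ 0
  occupied-replicate-0 zero    = refl
  occupied-replicate-0 (suc m) = occupied-replicate-0 m

  occupied-merge : ∀ {x y x′ y′} → Merge x y x′ y′ → ∀ Y →
                   occupied (x′ ∷ y′ ∷ Y) ≤ occupied (x ∷ y ∷ Y)
  occupied-merge (mergeˡ {y = zero}  _ ())
  occupied-merge (mergeˡ {zero}  {suc _} _ _) Y = ≤-refl
  occupied-merge (mergeˡ {suc _} {suc _} _ _) Y = s≤s (n≤1+n _)
  occupied-merge (mergeʳ {zero}  _ ())
  occupied-merge (mergeʳ {suc _} {zero}  _ _) Y = ≤-refl
  occupied-merge (mergeʳ {suc _} {suc _} _ _) Y = s≤s (n≤1+n _)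

  occupied-⇝ : ∀ {L T} → L ⇝ T → occupied T ≤ occupied L
  occupied-⇝ done = ≤-refl
  occupied-⇝ (step X Y refl m r) = ≤-trans (occupied-⇝ r)
    (subst₂ _≤_ (sym (occupied-++ X _)) (sym (occupied-++ X _)) (+-monoʳ-≤ (occupied X) (occupied-merge m Y)))

  -- Arms and blocks

  LeftArm : ℕ → List ℕ → Set
  LeftArm s []      = ⊤
  LeftArm s (a ∷ A) = s ≤ a × 0 < a × LeftArm (a + s) A

  RightArm : List ℕ → Set
  RightArm []      = ⊤
  RightArm (b ∷ B) = sum B ≤ b × 0 < b × RightArm B

  -- A root of weight c absorbs arms of total weights L and R, one after the other.
  Absorbs : ℕ → ℕ → ℕ → Set
  Absorbs c L R = (L ≤ c × R ≤ c + L) ⊎ (R ≤ c × L ≤ c + R)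

  record Block (A : List ℕ) (c : ℕ) (B : List ℕ) : Set where
    constructor mkBlock
    field
      left    : LeftArm 0 A
      right   : RightArm B
      root>0  : 0 < c
      absorbs : Absorbs c (sum A) (sum B)

  root-dominates-leftArm : ∀ {c L} → Absorbs c L 0 → L ≤ c
  root-dominates-leftArm (inj₁ (L≤c , _))   = L≤c
  root-dominates-leftArm (inj₂ (_ , L≤c+0)) = subst (_ ≤_) (+-identityʳ _) L≤c+0

  root-dominates-rightArm : ∀ {c R} → Absorbs c 0 R → R ≤ c
  root-dominates-rightArm (inj₂ (R≤c , _))   = R≤c
  root-dominates-rightArm (inj₁ (_ , R≤c+0)) = subst (_ ≤_) (+-identityʳ _) R≤c+0

  sum-∷ʳ : ∀ A a → sum (A ∷ʳ a) ≡ sum A + a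
  sum-∷ʳ A a = trans (sum-++ A [ a ]) (cong (sum A +_) (+-identityʳ a))

  sum-≤-++ˡ : ∀ P Q → sum P ≤ sum (P ++ Q)
  sum-≤-++ˡ P Q = subst (sum P ≤_) (sym (sum-++ P Q)) (m≤m+n (sum P) (sum Q))

  sum-≤-++ʳ : ∀ P Q → sum Q ≤ sum (P ++ Q)
  sum-≤-++ʳ P Q = subst (sum Q ≤_) (sym (sum-++ P Q)) (m≤n+m (sum Q) (sum P))

  +-assoc-comm : ∀ m n o → m + (n + o) ≡ n + m + o
  +-assoc-comm m n o = trans (sym (+-assoc m n o)) (cong (_+ o) (+-comm m n))

  LeftArm-weaken : ∀ {s s′} A → s′ ≤ s → LeftArm s A → LeftArm s′ A
  LeftArm-weaken []      _    _            = tt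
  LeftArm-weaken (a ∷ A) s′≤s (s≤a , a>0 , arm) =
    ≤-trans s′≤s s≤a , a>0 , LeftArm-weaken A (+-monoʳ-≤ a s′≤s) arm

  LeftArm-++⁻ : ∀ s P Q → LeftArm s (P ++ Q) → LeftArm s P × LeftArm (sum P + s) Q
  LeftArm-++⁻ s []      Q arm = tt , arm
  LeftArm-++⁻ s (p ∷ P) Q (s≤p , p>0 , arm) with LeftArm-++⁻ (p + s) P Q arm
  ... | armP , armQ = (s≤p , p>0 , armP) , subst (λ t → LeftArm t Q) (+-assoc-comm (sum P) p s) armQ

  LeftArm-split : ∀ P a Q → LeftArm 0 (P ++ a ∷ Q) → LeftArm 0 P × sum P ≤ a × 0 < a
  LeftArm-split P a Q arm with LeftArm-++⁻ 0 P (a ∷ Q) arm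
  ... | armP , (P≤a , a>0 , _) = armP , subst (_≤ a) (+-identityʳ (sum P)) P≤a , a>0

  LeftArm-∷ʳ : ∀ s P c → LeftArm s P → sum P + s ≤ c → 0 < c → LeftArm s (P ∷ʳ c)
  LeftArm-∷ʳ s []      c _ s≤c c>0 = s≤c , c>0 , tt
  LeftArm-∷ʳ s (p ∷ P) c (s≤p , p>0 , arm) P≤c c>0 =
    s≤p , p>0 , LeftArm-∷ʳ (p + s) P c arm (subst (_≤ c) (sym (+-assoc-comm (sum P) p s)) P≤c) c>0

  RightArm-++⁻ : ∀ P Q → RightArm (P ++ Q) → RightArm P × RightArm Q
  RightArm-++⁻ []      Q arm = tt , arm
  RightArm-++⁻ (p ∷ P) Q (PQ≤p , p>0 , arm) with RightArm-++⁻ P Q arm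
  ... | armP , armQ = (≤-trans (sum-≤-++ˡ P Q) PQ≤p , p>0 , armP) , armQ

  absorbRightArm : ∀ t B Z → RightArm B → sum B ≤ t →
                   t ∷ B ++ Z ⇝ (t + sum B) ∷ replicate (length B) 0 ++ Z
  absorbRightArm t []      Z _ _ = subst (λ u → t ∷ Z ⇝ u ∷ Z) (sym (+-identityʳ t)) done
  absorbRightArm t (b ∷ B) Z (B≤b , b>0 , arm) bB≤t =
    ⇝-trans (⇝-++ˡ [ t ] (absorbRightArm b B Z arm B≤b))
            (step [] _ refl (mergeˡ bB≤t (<-≤-trans b>0 (m≤m+n b (sum B)))) done)

  pushThroughLeftArm : ∀ p A c Z → 0 < p → LeftArm p A → sum A + p ≤ c →
                       p ∷ A ++ c ∷ Z ⇝ replicate (suc (length A)) 0 ++ (c + (sum A + p)) ∷ Z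
  pushThroughLeftArm p []      c Z p>0 _ p≤c = step [] Z refl (mergeʳ p≤c p>0) done
  pushThroughLeftArm p (a ∷ A) c Z p>0 (p≤a , a>0 , arm) aAp≤c =
    step [] _ refl (mergeʳ p≤a p>0)
      (subst (λ u → 0 ∷ (a + p) ∷ A ++ c ∷ Z ⇝ 0 ∷ replicate (suc (length A)) 0 ++ (c + u) ∷ Z)
             (+-assoc-comm (sum A) a p)
             (⇝-++ˡ [ 0 ] (pushThroughLeftArm (a + p) A c Z (<-≤-trans a>0 (m≤m+n a p)) arm
                             (subst (_≤ c) (sym (+-assoc-comm (sum A) a p)) aAp≤c))))

  sweepLeftArm : ∀ A c Z → LeftArm 0 A → sum A ≤ c →
                 A ++ c ∷ Z ⇝ replicate (length A) 0 ++ (c + sum A) ∷ Z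
  sweepLeftArm []      c Z _ _ = subst (λ u → c ∷ Z ⇝ u ∷ Z) (sym (+-identityʳ c)) done
  sweepLeftArm (a ∷ A) c Z (_ , a>0 , arm) aA≤c =
    subst (λ u → a ∷ A ++ c ∷ Z ⇝ replicate (suc (length A)) 0 ++ (c + u) ∷ Z) (+-comm (sum A) a)
      (pushThroughLeftArm a A c Z a>0 (LeftArm-weaken A (m≤m+n a 0) arm)
                          (subst (_≤ c) (+-comm a (sum A)) aA≤c))

  collapseBlock : ∀ {A c B} → Block A c B → ∀ Z →
    (A ++ c ∷ B) ++ Z ⇝ (replicate (length A) 0 ++ sum (A ++ c ∷ B) ∷ replicate (length B) 0) ++ Z
  collapseBlock {A} {c} {B} (mkBlock left right _ (inj₁ (A≤c , B≤cA))) Z =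
    subst₂ _⇝_ (sym (++-assoc A (c ∷ B) Z)) (sym (++-assoc zA _ Z))
      (subst (λ u → A ++ c ∷ B ++ Z ⇝ zA ++ u ∷ replicate (length B) 0 ++ Z) total
        (⇝-trans (sweepLeftArm A c (B ++ Z) left A≤c)
                 (⇝-++ˡ zA (absorbRightArm (c + sum A) B Z right B≤cA))))
    where
    zA = replicate (length A) 0
    total : c + sum A + sum B ≡ sum (A ++ c ∷ B)
    total = trans (cong (_+ sum B) (+-comm c (sum A)))
                  (trans (+-assoc (sum A) c (sum B)) (sym (sum-++ A (c ∷ B))))
  collapseBlock {A} {c} {B} (mkBlock left right _ (inj₂ (B≤c , A≤cB))) Z =
    subst₂ _⇝_ (sym (++-assoc A (c ∷ B) Z)) (sym (++-assoc zA _ Z))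
      (subst (λ u → A ++ c ∷ B ++ Z ⇝ zA ++ u ∷ replicate (length B) 0 ++ Z) total
        (⇝-trans (⇝-++ˡ A (absorbRightArm c B Z right B≤c))
                 (sweepLeftArm A (c + sum B) (replicate (length B) 0 ++ Z) left A≤cB)))
    where
    zA = replicate (length A) 0
    total : c + sum B + sum A ≡ sum (A ++ c ∷ B)
    total = trans (+-comm (c + sum B) (sum A)) (sym (sum-++ A (c ∷ B)))

  -- Decompositions into parts

  data Part : Set where
    vacant : Part
    block  : List ℕ → ℕ → List ℕ → Part

  Valid : Part → Set
  Valid vacant        = ⊤
  Valid (block A c B) = Block A c B

  partWeights : Part → List ℕ
  partWeights vacant        = [ 0 ]
  partWeights (block A c B) = A ++ c ∷ B

  partCollapsed : Part → List ℕ
  partCollapsed vacant        = [ 0 ]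
  partCollapsed (block A c B) = replicate (length A) 0 ++ sum (A ++ c ∷ B) ∷ replicate (length B) 0

  isBlock : Part → ℕ
  isBlock vacant        = 0
  isBlock (block _ _ _) = 1

  weights collapsed : List Part → List ℕ
  weights   = concatMap partWeights
  collapsed = concatMap partCollapsed

  #blocks : List Part → ℕ
  #blocks ps = sum (map isBlock ps)

  #blocks-++ : ∀ ps qs → #blocks (ps ++ qs) ≡ #blocks ps + #blocks qs
  #blocks-++ ps qs = trans (cong sum (map-++ isBlock ps qs)) (sum-++ (map isBlock ps) (map isBlock qs))

  collapse : ∀ {ps} → All Valid ps → weights ps ⇝ collapsed ps
  collapse []                 = done
  collapse {vacant ∷ _} (_ ∷ valid) = ⇝-++ˡ [ 0 ] (collapse valid)
  collapse {block A c B ∷ ps} (b ∷ valid) =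
    ⇝-trans (collapseBlock b (weights ps)) (⇝-++ˡ (partCollapsed (block A c B)) (collapse valid))

  occupied-partCollapsed : ∀ {p} → Valid p → occupied (partCollapsed p) ≡ isBlock p
  occupied-partCollapsed {vacant} _ = refl
  occupied-partCollapsed {block A c B} b = begin
    occupied (replicate (length A) 0 ++ sum (A ++ c ∷ B) ∷ replicate (length B) 0)
      ≡⟨ occupied-++ (replicate (length A) 0) _ ⟩
    occupied (replicate (length A) 0) + occupied (sum (A ++ c ∷ B) ∷ replicate (length B) 0)
      ≡⟨ cong₂ _+_ (occupied-replicate-0 (length A)) (occupied-positive∷ sum>0) ⟩
    suc (occupied (replicate (length B) 0))
      ≡⟨ cong suc (occupied-replicate-0 (length B)) ⟩
    1 ∎
    where
    open ≡-Reasoning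
    sum>0 : 0 < sum (A ++ c ∷ B)
    sum>0 = subst (0 <_) (sym (sum-++ A (c ∷ B)))
                  (<-≤-trans (Block.root>0 b) (≤-trans (m≤m+n c (sum B)) (m≤n+m _ (sum A))))
    occupied-positive∷ : ∀ {t Z} → 0 < t → occupied (t ∷ Z) ≡ suc (occupied Z)
    occupied-positive∷ {suc _} _ = refl

  occupied-collapsed : ∀ {ps} → All Valid ps → occupied (collapsed ps) ≡ #blocks ps
  occupied-collapsed []                  = refl
  occupied-collapsed {p ∷ ps} (v ∷ valid) =
    trans (occupied-++ (partCollapsed p) (collapsed ps))
          (cong₂ _+_ (occupied-partCollapsed v) (occupied-collapsed valid))

  ++-overlap : ∀ {A : Set} (P Q X R : List A) → P ++ Q ≡ X ++ R →
    (∃ λ M → X ≡ P ++ M × Q ≡ M ++ R) ⊎ (∃ λ m → ∃ λ M → P ≡ X ++ m ∷ M × m ∷ M ++ Q ≡ R)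
  ++-overlap []      Q X       R e = inj₁ (X , refl , e)
  ++-overlap (p ∷ P) Q []      R e = inj₂ (p , P , refl , e)
  ++-overlap (p ∷ P) Q (x ∷ X) R e with ∷-injective e
  ... | refl , e′ with ++-overlap P Q X R e′
  ...   | inj₁ (M , e₁ , e₂)     = inj₁ (M , cong (p ∷_) e₁ , e₂)
  ...   | inj₂ (m , M , e₁ , e₂) = inj₂ (m , M , cong (p ∷_) e₁ , e₂)

  replicate-0-entry : ∀ k X {x M} → replicate k 0 ≡ X ++ x ∷ M → x ≡ 0
  replicate-0-entry (suc k) []      e = sym (proj₁ (∷-injective e))
  replicate-0-entry (suc k) (_ ∷ X) e = replicate-0-entry k X (proj₂ (∷-injective e))

  lone-positive : ∀ m k t X {x M} → replicate m 0 ++ t ∷ replicate k 0 ≡ X ++ x ∷ M → 0 < x →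
                  X ≡ replicate m 0 × x ≡ t × M ≡ replicate k 0
  lone-positive zero    k t []      refl _ = refl , refl , refl
  lone-positive zero    k t (_ ∷ X) e x>0 with replicate-0-entry k X (proj₂ (∷-injective e))
  ... | refl = ⊥-elim (<-irrefl refl x>0)
  lone-positive (suc m) k t []      refl ()
  lone-positive (suc m) k t (_ ∷ X) e x>0 with ∷-injective e
  ... | refl , e′ with lone-positive m k t X e′ x>0
  ...   | refl , refl , refl = refl , refl , refl

  data RootAt : List Part → List ℕ → ℕ → List ℕ → Set where
    root-at : ∀ ps₁ A c B ps₂ →
      RootAt (ps₁ ++ block A c B ∷ ps₂) (collapsed ps₁ ++ replicate (length A) 0)
             (sum (A ++ c ∷ B)) (replicate (length B) 0 ++ collapsed ps₂)

  -- Collapsing leaves the weight of a block on its root and zeros elsewhere.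
  positive-entry : ∀ ps X {x Z} → collapsed ps ≡ X ++ x ∷ Z → 0 < x → RootAt ps X x Z
  positive-entry []                 []      ()
  positive-entry []                 (_ ∷ _) ()
  positive-entry (vacant ∷ ps)      []      refl ()
  positive-entry (vacant ∷ ps)      (_ ∷ X) e x>0 with ∷-injective e
  ... | refl , e′ with positive-entry ps X e′ x>0
  ...   | root-at ps₁ A c B ps₂ = root-at (vacant ∷ ps₁) A c B ps₂
  positive-entry (block A c B ∷ ps) X e x>0
    with ++-overlap (partCollapsed (block A c B)) (collapsed ps) X _ e
  ... | inj₁ (M , refl , e′) with positive-entry ps M e′ x>0
  ...   | root-at ps₁ A₁ c₁ B₁ ps₂ =
    subst (λ Y → RootAt (block A c B ∷ ps₁ ++ block A₁ c₁ B₁ ∷ ps₂) Y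
                        (sum (A₁ ++ c₁ ∷ B₁)) (replicate (length B₁) 0 ++ collapsed ps₂))
          (++-assoc (partCollapsed (block A c B)) (collapsed ps₁) _)
          (root-at (block A c B ∷ ps₁) A₁ c₁ B₁ ps₂)
  positive-entry (block A c B ∷ ps) X e x>0 | inj₂ (m , M , e₁ , e₂) with ∷-injective e₂
  ... | refl , refl with lone-positive (length A) (length B) (sum (A ++ c ∷ B)) X e₁ x>0
  ...   | refl , refl , refl = root-at [] A c B ps

  data AdjacentRoots : List Part → List ℕ → ℕ → ℕ → List ℕ → Set where
    adjacent-roots : ∀ ps₁ A c c′ B′ ps₂ →
      AdjacentRoots (ps₁ ++ block A c [] ∷ block [] c′ B′ ∷ ps₂)
                    (collapsed ps₁ ++ replicate (length A) 0) (sum (A ++ c ∷ [])) (c′ + sum B′)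
                    (replicate (length B′) 0 ++ collapsed ps₂)

  private
    right-neighbour : ∀ ps₁ A c {ps₂ X′ y Y} → RootAt ps₂ X′ y Y → X′ ≡ [] →
      AdjacentRoots (ps₁ ++ block A c [] ∷ ps₂) (collapsed ps₁ ++ replicate (length A) 0) (sum (A ++ c ∷ [])) y Y
    right-neighbour ps₁ A c (root-at [] [] c′ B′ ps₂)       refl = adjacent-roots ps₁ A c c′ B′ ps₂
    right-neighbour ps₁ A c (root-at [] (_ ∷ _) _ _ _)      ()
    right-neighbour ps₁ A c (root-at (vacant ∷ _) _ _ _ _)  ()
    right-neighbour ps₁ A c (root-at (block [] _ _ ∷ _) _ _ _ _) ()
    right-neighbour ps₁ A c (root-at (block (_ ∷ _) _ _ ∷ _) _ _ _ _) ()

    left-neighbour : ∀ {ps X x Z y Y} → RootAt ps X x Z → Z ≡ y ∷ Y → 0 < y → AdjacentRoots ps X x y Y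
    left-neighbour (root-at ps₁ A c (_ ∷ _) ps₂) refl ()
    left-neighbour (root-at ps₁ A c [] ps₂) e y>0 = right-neighbour ps₁ A c (positive-entry ps₂ [] e y>0) refl

  adjacentRoots : ∀ ps X {x y Y} → collapsed ps ≡ X ++ x ∷ y ∷ Y → 0 < x → 0 < y → AdjacentRoots ps X x y Y
  adjacentRoots ps X e x>0 y>0 = left-neighbour (positive-entry ps X e x>0) refl y>0

  Collapsible : List ℕ → List ℕ → Set
  Collapsible ws T = ∃ λ ps → All Valid ps × weights ps ≡ ws × collapsed ps ≡ T

  weights-split : ∀ ps₁ q q₁ q₂ ps₂ → partWeights q ≡ partWeights q₁ ++ partWeights q₂ →
                  weights (ps₁ ++ q ∷ ps₂) ≡ weights (ps₁ ++ q₁ ∷ q₂ ∷ ps₂)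
  weights-split ps₁ q q₁ q₂ ps₂ e = begin
    weights (ps₁ ++ q ∷ ps₂)                      ≡⟨ concatMap-++ partWeights ps₁ _ ⟩
    weights ps₁ ++ partWeights q ++ weights ps₂   ≡⟨ cong (λ l → weights ps₁ ++ l ++ weights ps₂) e ⟩
    weights ps₁ ++ (partWeights q₁ ++ partWeights q₂) ++ weights ps₂
      ≡⟨ cong (weights ps₁ ++_) (++-assoc (partWeights q₁) _ _) ⟩
    weights ps₁ ++ partWeights q₁ ++ partWeights q₂ ++ weights ps₂
      ≡⟨ concatMap-++ partWeights ps₁ _ ⟨
    weights (ps₁ ++ q₁ ∷ q₂ ∷ ps₂)                ∎
    where open ≡-Reasoning

  collapsed-split : ∀ ps₁ q ps₂ {L R} → partCollapsed q ≡ L ++ R →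
                    collapsed (ps₁ ++ q ∷ ps₂) ≡ (collapsed ps₁ ++ L) ++ R ++ collapsed ps₂
  collapsed-split ps₁ q ps₂ {L} {R} e = begin
    collapsed (ps₁ ++ q ∷ ps₂)                        ≡⟨ concatMap-++ partCollapsed ps₁ _ ⟩
    collapsed ps₁ ++ partCollapsed q ++ collapsed ps₂ ≡⟨ cong (λ l → collapsed ps₁ ++ l ++ collapsed ps₂) e ⟩
    collapsed ps₁ ++ (L ++ R) ++ collapsed ps₂        ≡⟨ cong (collapsed ps₁ ++_) (++-assoc L R _) ⟩
    collapsed ps₁ ++ L ++ R ++ collapsed ps₂          ≡⟨ ++-assoc (collapsed ps₁) L _ ⟨
    (collapsed ps₁ ++ L) ++ R ++ collapsed ps₂        ∎
    where open ≡-Reasoning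

  replicate-length-∷ʳ : ∀ (A : List ℕ) c → replicate (length (A ∷ʳ c)) 0 ≡ replicate (length A) 0 ∷ʳ 0
  replicate-length-∷ʳ []      c = refl
  replicate-length-∷ʳ (_ ∷ A) c = cong (0 ∷_) (replicate-length-∷ʳ A c)

  merge-positive : ∀ {x y x′ y′} → Merge x y x′ y′ → 0 < x × 0 < y
  merge-positive (mergeˡ y≤x y>0) = <-≤-trans y>0 y≤x , y>0
  merge-positive (mergeʳ x≤y x>0) = x>0 , <-≤-trans x>0 x≤y

  -- The absorbed root, with its outer arm, becomes the inner end of the absorbing block's arm.
  merge-adjacent : ∀ {ps X x y Y x′ y′} → AdjacentRoots ps X x y Y → All Valid ps → Merge x y x′ y′ →
                   Collapsible (weights ps) (X ++ x′ ∷ y′ ∷ Y)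
  merge-adjacent (adjacent-roots ps₁ A c c′ B′ ps₂) valid (mergeˡ y≤x _)
    with All.++⁻ ps₁ valid
  ... | valid₁ , mkBlock left _ c>0 absorbs ∷ mkBlock _ right c′>0 absorbs′ ∷ valid₂ =
    ps₁ ++ block A c (c′ ∷ B′) ∷ ps₂ ,
    All.++⁺ valid₁ (block′ ∷ valid₂) ,
    weights-split ps₁ _ (block A c []) (block [] c′ B′) ps₂
      (sym (++-assoc A (c ∷ []) (c′ ∷ B′))) ,
    collapsed-split ps₁ _ ps₂ (cong (λ s → replicate (length A) 0 ++ s ∷ 0 ∷ replicate (length B′) 0) total)
    where
    block′ : Block A c (c′ ∷ B′)
    block′ = mkBlock left (root-dominates-rightArm absorbs′ , c′>0 , right) c>0
                     (inj₁ (root-dominates-leftArm absorbs ,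
                            subst (c′ + sum B′ ≤_) (trans (sum-∷ʳ A c) (+-comm (sum A) c)) y≤x))
    total : sum (A ++ c ∷ c′ ∷ B′) ≡ sum (A ++ c ∷ []) + (c′ + sum B′)
    total = trans (cong sum (sym (++-assoc A (c ∷ []) (c′ ∷ B′)))) (sum-++ (A ++ c ∷ []) (c′ ∷ B′))
  merge-adjacent (adjacent-roots ps₁ A c c′ B′ ps₂) valid (mergeʳ x≤y _)
    with All.++⁻ ps₁ valid
  ... | valid₁ , mkBlock left _ c>0 absorbs ∷ mkBlock _ right c′>0 absorbs′ ∷ valid₂ =
    ps₁ ++ block (A ∷ʳ c) c′ B′ ∷ ps₂ ,
    All.++⁺ valid₁ (block′ ∷ valid₂) ,
    weights-split ps₁ _ (block A c []) (block [] c′ B′) ps₂ refl ,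
    collapsed-split ps₁ _ ps₂
      (trans (cong₂ (λ Z s → Z ++ s ∷ replicate (length B′) 0) (replicate-length-∷ʳ A c) total)
             (++-assoc (replicate (length A) 0) [ 0 ] _))
    where
    block′ : Block (A ∷ʳ c) c′ B′
    block′ = mkBlock (LeftArm-∷ʳ 0 A c left (subst (_≤ c) (sym (+-identityʳ (sum A))) (root-dominates-leftArm absorbs)) c>0)
                     right c′>0 (inj₂ (root-dominates-rightArm absorbs′ , x≤y))
    total : sum ((A ∷ʳ c) ++ c′ ∷ B′) ≡ c′ + sum B′ + sum (A ∷ʳ c)
    total = trans (sum-++ (A ∷ʳ c) (c′ ∷ B′)) (+-comm (sum (A ∷ʳ c)) (c′ + sum B′))

  collapsible-refl : ∀ ws → Collapsible ws ws
  collapsible-refl []           = [] , [] , refl , refl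
  collapsible-refl (zero ∷ ws) with collapsible-refl ws
  ... | ps , valid , w≡ , c≡ = vacant ∷ ps , _ ∷ valid , cong (0 ∷_) w≡ , cong (0 ∷_) c≡
  collapsible-refl (suc x ∷ ws) with collapsible-refl ws
  ... | ps , valid , w≡ , c≡ =
    block [] (suc x) [] ∷ ps , mkBlock _ _ (s≤s z≤n) (inj₁ (z≤n , z≤n)) ∷ valid ,
    cong (suc x ∷_) w≡ , cong₂ _∷_ (+-identityʳ (suc x)) c≡

  collapsible-⇝ : ∀ {ws L T} → Collapsible ws L → L ⇝ T → Collapsible ws T
  collapsible-⇝ c done = c
  collapsible-⇝ (ps , valid , refl , refl) (step X Y e m r) with merge-positive m
  ... | x>0 , y>0 = collapsible-⇝ (merge-adjacent (adjacentRoots ps X e x>0 y>0) valid m) r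

  -- Changing one weight

  Decomposable : List ℕ → ℕ → Set
  Decomposable ws k = ∃ λ ps → All Valid ps × weights ps ≡ ws × #blocks ps ≤ k

  decomposable-cast : ∀ {P P′ k k′} → P ≡ P′ → k ≤ k′ → Decomposable P k → Decomposable P′ k′
  decomposable-cast refl k≤k′ (ps , valid , w≡ , n≤k) = ps , valid , w≡ , ≤-trans n≤k k≤k′

  decomposable-++ : ∀ {P Q k l} → Decomposable P k → Decomposable Q l → Decomposable (P ++ Q) (k + l)
  decomposable-++ (ps , valid , refl , n≤k) (qs , valid′ , refl , n≤l) =
    ps ++ qs , All.++⁺ valid valid′ , concatMap-++ partWeights ps qs ,
    subst (_≤ _) (sym (#blocks-++ ps qs)) (+-mono-≤ n≤k n≤l)

  nil-decomposable : Decomposable [] 0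
  nil-decomposable = [] , [] , refl , z≤n

  vacant-decomposable : Decomposable [ 0 ] 0
  vacant-decomposable = vacant ∷ [] , _ ∷ [] , refl , z≤n

  part-decomposable : ∀ {p} → Valid p → Decomposable (partWeights p) (isBlock p)
  part-decomposable v = _ ∷ [] , v ∷ [] , ++-identityʳ _ , ≤-reflexive (+-identityʳ _)

  block-decomposable : ∀ {A c B} → Block A c B → Decomposable (A ++ c ∷ B) 1
  block-decomposable {A} {c} {B} = part-decomposable {block A c B}

  decomposable⇒⇝ : ∀ {ws k} → Decomposable ws k → ∃ λ T → ws ⇝ T × occupied T ≤ k
  decomposable⇒⇝ (ps , valid , refl , n≤k) =
    collapsed ps , collapse valid , subst (_≤ _) (sym (occupied-collapsed valid)) n≤k

  rightArm-decomposable : ∀ B → RightArm B → Decomposable B 1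
  rightArm-decomposable []      _ = decomposable-cast refl z≤n nil-decomposable
  rightArm-decomposable (b ∷ B) (B≤b , b>0 , arm) =
    block-decomposable (mkBlock tt arm b>0 (inj₁ (z≤n , subst (sum B ≤_) (sym (+-identityʳ b)) B≤b)))

  -- The root is the innermost entry of the heavier side.
  arms-decomposable : ∀ L B → LeftArm 0 L → RightArm B → Decomposable (L ++ B) 1
  arms-decomposable L B left right with initLast L
  arms-decomposable .[] B _ right | [] = rightArm-decomposable B right
  arms-decomposable .(L′ ∷ʳ l) B left right | L′ ∷ʳ′ l
    with LeftArm-split L′ l [] left | sum B ≤? l + sum L′
  ... | left′ , L′≤l , l>0 | yes B≤ =
    decomposable-cast (sym (++-assoc L′ [ l ] B)) ≤-refl
      (block-decomposable (mkBlock left′ right l>0 (inj₁ (L′≤l , B≤))))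
  arms-decomposable .(L′ ∷ʳ l) []       left right | L′ ∷ʳ′ l | _ | no B≰ = ⊥-elim (B≰ z≤n)
  arms-decomposable .(L′ ∷ʳ l) (b ∷ B′) left (B′≤b , b>0 , right′) | L′ ∷ʳ′ l | _ | no B≰ =
    block-decomposable (mkBlock left right′ b>0
      (inj₂ (B′≤b , subst (_≤ b + sum B′) (trans (+-comm l (sum L′)) (sym (sum-∷ʳ L′ l))) (<⇒≤ (≰⇒> B≰)))))

  leftArm-decomposable : ∀ L → LeftArm 0 L → Decomposable L 1
  leftArm-decomposable L left = decomposable-cast (++-identityʳ L) ≤-refl (arms-decomposable L [] left tt)

  rooted-arms-decomposable : ∀ {A c B} → LeftArm 0 A → RightArm B → 0 < c → sum A ≤ c ⊎ sum B ≤ c →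
                             Decomposable (A ++ c ∷ B) 1
  rooted-arms-decomposable {A} {c} {B} left right c>0 (inj₁ A≤c) =
    decomposable-cast (++-assoc A [ c ] B) ≤-refl
      (arms-decomposable (A ∷ʳ c) B (LeftArm-∷ʳ 0 A c left (subst (_≤ c) (sym (+-identityʳ (sum A))) A≤c) c>0) right)
  rooted-arms-decomposable {A} left right c>0 (inj₂ B≤c) = arms-decomposable A _ left (B≤c , c>0 , right)

  leftArm-∷ʳ-decomposable : ∀ A d → LeftArm 0 A → Decomposable (A ∷ʳ d) 1
  leftArm-∷ʳ-decomposable A zero    left =
    decomposable-cast refl (≤-reflexive (+-identityʳ 1)) (decomposable-++ (leftArm-decomposable A left) vacant-decomposable)
  leftArm-∷ʳ-decomposable A (suc d) left = arms-decomposable A [ suc d ] left (z≤n , s≤s z≤n , tt)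

  ∷-rightArm-decomposable : ∀ d B → RightArm B → Decomposable (d ∷ B) 1
  ∷-rightArm-decomposable zero    B right = decomposable-++ vacant-decomposable (rightArm-decomposable B right)
  ∷-rightArm-decomposable (suc d) B right = arms-decomposable [ suc d ] B (z≤n , s≤s z≤n , tt) right

  Absorbs-oneArm : ∀ {c L R} → Absorbs c L R → L ≤ c ⊎ R ≤ c
  Absorbs-oneArm = ⊎-map proj₁ proj₁

  block-prefix : ∀ {A c} B Q → Block A c (B ++ Q) → Decomposable (A ++ c ∷ B) 1
  block-prefix B Q (mkBlock left right c>0 absorbs) =
    rooted-arms-decomposable left (proj₁ (RightArm-++⁻ B Q right)) c>0
      (map₂ (≤-trans (sum-≤-++ˡ B Q)) (Absorbs-oneArm absorbs))

  block-suffix : ∀ P A {c B} → Block (P ++ A) c B → Decomposable (A ++ c ∷ B) 1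
  block-suffix P A (mkBlock left right c>0 absorbs) =
    rooted-arms-decomposable (LeftArm-weaken A z≤n (proj₂ (LeftArm-++⁻ 0 P A left))) right c>0
      (map₁ (≤-trans (sum-≤-++ʳ P A)) (Absorbs-oneArm absorbs))

  data BlockPosition : List ℕ → ℕ → List ℕ → List ℕ → ℕ → List ℕ → Set where
    in-left  : ∀ X a A′ c B → BlockPosition (X ++ a ∷ A′) c B X a (A′ ++ c ∷ B)
    at-root  : ∀ A c B → BlockPosition A c B A c B
    in-right : ∀ A c B′ a M → BlockPosition A c (B′ ++ a ∷ M) (A ++ c ∷ B′) a M

  blockPosition : ∀ A c B X {a M} → A ++ c ∷ B ≡ X ++ a ∷ M → BlockPosition A c B X a M
  blockPosition []      c B []      refl = at-root [] c B
  blockPosition []      c B (x ∷ X) e with ∷-injective e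
  ... | refl , refl = in-right [] c X _ _
  blockPosition (a ∷ A) c B []      refl = in-left [] a A c B
  blockPosition (a ∷ A) c B (x ∷ X) e with ∷-injective e
  ... | refl , e′ with blockPosition A c B X e′
  ...   | in-left X a′ A′ c B   = in-left (x ∷ X) a′ A′ c B
  ...   | at-root A c B         = at-root (x ∷ A) c B
  ...   | in-right A c B′ a′ M  = in-right (x ∷ A) c B′ a′ M

  PartPerturbation : ℕ → ℕ → Set
  PartPerturbation a a′ = ∀ p X M → Valid p → partWeights p ≡ X ++ a ∷ M →
                          Decomposable (X ++ a′ ∷ M) (suc (isBlock p))

  add-chip : ∀ a → PartPerturbation a (suc a)
  add-chip a vacant []          M _ refl = block-decomposable (mkBlock tt tt (s≤s z≤n) (inj₁ (z≤n , z≤n)))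
  add-chip a vacant (_ ∷ [])    M _ ()
  add-chip a vacant (_ ∷ _ ∷ _) M _ ()
  add-chip a (block A c B) X M b e with blockPosition A c B X e | b
  ... | at-root A c B | mkBlock left right _ absorbs =
    decomposable-cast refl (n≤1+n 1)
      (rooted-arms-decomposable left right (s≤s z≤n) (⊎-map m≤n⇒m≤1+n m≤n⇒m≤1+n (Absorbs-oneArm absorbs)))
  ... | in-right A c B′ a M | b′ with RightArm-++⁻ B′ (a ∷ M) (Block.right b′)
  ...   | _ , (M≤a , _ , right) =
    decomposable-++ (block-prefix B′ (a ∷ M) b′)
                    (rightArm-decomposable (suc a ∷ M) (m≤n⇒m≤1+n M≤a , s≤s z≤n , right))
  add-chip a (block A c B) X M b e | in-left X a A′ c B | b′ with LeftArm-split X a A′ (Block.left b′)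
  ... | left , X≤a , _ =
    decomposable-cast (++-assoc X [ suc a ] (A′ ++ c ∷ B)) ≤-refl
      (decomposable-++ (leftArm-decomposable (X ∷ʳ suc a) (LeftArm-∷ʳ 0 X (suc a) left (m≤n⇒m≤1+n X+0≤a) (s≤s z≤n)))
                       (block-suffix (X ∷ʳ a) A′ (subst (λ L → Block L c B) (sym (++-assoc X [ a ] A′)) b′)))
    where
    X+0≤a : sum X + 0 ≤ a
    X+0≤a = subst (_≤ a) (sym (+-identityʳ (sum X))) X≤a

  remove-chip : ∀ a → PartPerturbation (suc a) a
  remove-chip a vacant []          M _ ()
  remove-chip a vacant (_ ∷ [])    M _ ()
  remove-chip a vacant (_ ∷ _ ∷ _) M _ ()
  remove-chip a (block A c B) X M b e with blockPosition A c B X e | b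
  ... | at-root A c B | mkBlock left right _ _ =
    decomposable-cast (++-assoc A [ a ] B) ≤-refl
      (decomposable-++ (leftArm-∷ʳ-decomposable A a left) (rightArm-decomposable B right))
  ... | in-right A c B′ _ M | b′ with RightArm-++⁻ B′ (suc a ∷ M) (Block.right b′)
  ...   | _ , (_ , _ , right) =
    decomposable-++ (block-prefix B′ (suc a ∷ M) b′) (∷-rightArm-decomposable a M right)
  remove-chip a (block A c B) X M b e | in-left X _ A′ c B | b′ with LeftArm-split X (suc a) A′ (Block.left b′)
  ... | left , _ , _ =
    decomposable-cast (++-assoc X [ a ] (A′ ++ c ∷ B)) ≤-refl
      (decomposable-++ (leftArm-∷ʳ-decomposable X a left)
                       (block-suffix (X ∷ʳ suc a) A′ (subst (λ L → Block L c B) (sym (++-assoc X [ suc a ] A′)) b′)))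

  perturb : ∀ {a a′} → PartPerturbation a a′ → ∀ ps X Y → All Valid ps → weights ps ≡ X ++ a ∷ Y →
            Decomposable (X ++ a′ ∷ Y) (suc (#blocks ps))
  perturb change []       []      Y _ ()
  perturb change []       (_ ∷ _) Y _ ()
  perturb change (p ∷ ps) X Y (v ∷ valid) e with ++-overlap (partWeights p) (weights ps) X _ e
  ... | inj₁ (M , refl , e′) =
    decomposable-cast (sym (++-assoc (partWeights p) M _)) (≤-reflexive (+-suc (isBlock p) (#blocks ps)))
      (decomposable-++ (part-decomposable v) (perturb change ps M Y valid e′))
  ... | inj₂ (m , M , e₁ , e₂) with ∷-injective e₂
  ...   | refl , refl =
    decomposable-cast (++-assoc X _ (weights ps)) ≤-refl
      (decomposable-++ (change p X M v e₁) (ps , valid , refl , ≤-refl))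

  ⇝-perturb : ∀ {a a′ ws T} → PartPerturbation a a′ → ∀ X Y → ws ≡ X ++ a ∷ Y → ws ⇝ T →
              ∃ λ T′ → X ++ a′ ∷ Y ⇝ T′ × occupied T′ ≤ suc (occupied T)
  ⇝-perturb change X Y e r with collapsible-⇝ (collapsible-refl _) r
  ... | ps , valid , refl , refl =
    decomposable⇒⇝ (decomposable-cast refl (s≤s (≤-reflexive (sym (occupied-collapsed valid))))
                                       (perturb change ps X Y valid e))

  adjacent-split : ∀ {n} (f : Fin n → ℕ) {a b : Fin n} → suc (toℕ a) ≡ toℕ b →
                   ∃₂ λ X Y → tabulate f ≡ X ++ f a ∷ f b ∷ Y × length X ≡ toℕ a
  adjacent-split f {zero}  {suc zero} refl = [] , tabulate (λ i → f (suc (suc i))) , refl , refl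
  adjacent-split f {suc a} {suc b}    e with adjacent-split (f ∘ suc) (suc-injective e)
  ... | X , Y , e′ , len = f zero ∷ X , Y , cong (f zero ∷_) e′ , cong suc len

  adjacent-entries : ∀ {n} (f : Fin n → ℕ) X {x y Y} → tabulate f ≡ X ++ x ∷ y ∷ Y →
    ∃₂ λ a b → suc (toℕ a) ≡ toℕ b × length X ≡ toℕ a × f a ≡ x × f b ≡ y
  adjacent-entries {suc (suc n)} f [] e with ∷-injective e
  ... | fa≡x , e′ = zero , suc zero , refl , refl , fa≡x , proj₁ (∷-injective e′)
  adjacent-entries {suc n} f (_ ∷ X) e with adjacent-entries (f ∘ suc) X (proj₂ (∷-injective e))
  ... | a , b , adj , len , fa≡x , fb≡y = suc a , suc b , cong suc adj , cong suc len , fa≡x , fb≡y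
  adjacent-entries {zero}        f []          ()
  adjacent-entries {zero}        f (_ ∷ _)     ()
  adjacent-entries {suc zero}    f []          ()

  tabulate-update₂ : ∀ {n} (f g : Fin n → ℕ) {a b : Fin n} → suc (toℕ a) ≡ toℕ b →
    (∀ z → toℕ z ≢ toℕ a → toℕ z ≢ toℕ b → f z ≡ g z) →
    ∀ X {x y Y} → tabulate f ≡ X ++ x ∷ y ∷ Y → length X ≡ toℕ a → tabulate g ≡ X ++ g a ∷ g b ∷ Y
  tabulate-update₂ f g {zero} {suc zero} refl agree [] e refl =
    cong (λ Y → g zero ∷ g (suc zero) ∷ Y)
         (trans (tabulate-cong (λ z → sym (agree (suc (suc z)) (λ ()) (λ ()))))
                (proj₂ (∷-injective (proj₂ (∷-injective e)))))
  tabulate-update₂ f g {suc a} {suc b} adj agree (_ ∷ X) e len with ∷-injective e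
  ... | refl , e′ =
    cong₂ _∷_ (sym (agree zero (λ ()) (λ ())))
      (tabulate-update₂ (f ∘ suc) (g ∘ suc) (suc-injective adj)
        (λ z z≢a z≢b → agree (suc z) (z≢a ∘ suc-injective) (z≢b ∘ suc-injective)) X e′ (suc-injective len))

  tabulate-update₁ : ∀ {n} (f g : Fin n → ℕ) (a : Fin n) → (∀ z → toℕ z ≢ toℕ a → f z ≡ g z) →
    ∃₂ λ X Y → tabulate f ≡ X ++ f a ∷ Y × tabulate g ≡ X ++ g a ∷ Y
  tabulate-update₁ f g zero agree =
    [] , tabulate (f ∘ suc) , refl , cong (g zero ∷_) (tabulate-cong (λ z → sym (agree (suc z) (λ ()))))
  tabulate-update₁ f g (suc a) agree
    with tabulate-update₁ (f ∘ suc) (g ∘ suc) a (λ z z≢a → agree (suc z) (z≢a ∘ suc-injective))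
  ... | X , Y , e , e′ = f zero ∷ X , Y , cong (f zero ∷_) e , cong₂ _∷_ (sym (agree zero (λ ()))) e′

  transfer-acquirer : ∀ {n} (w : Weight n) u v → transfer w u v u ≡ w u + w v
  transfer-acquirer w u v with u ≟ u
  ... | yes _   = refl
  ... | no u≢u = ⊥-elim (u≢u refl)

  transfer-acquired : ∀ {n} (w : Weight n) u v → toℕ u ≢ toℕ v → transfer w u v v ≡ 0
  transfer-acquired w u v u≢v with v ≟ u | v ≟ v
  ... | yes refl | _     = ⊥-elim (u≢v refl)
  ... | no _     | yes _ = refl
  ... | no _     | no v≢v = ⊥-elim (v≢v refl)

  transfer-other : ∀ {n} (w : Weight n) u v z → toℕ z ≢ toℕ u → toℕ z ≢ toℕ v → w z ≡ transfer w u v z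
  transfer-other w u v z z≢u z≢v with z ≟ u | z ≟ v
  ... | yes refl | _        = ⊥-elim (z≢u refl)
  ... | no _     | yes refl = ⊥-elim (z≢v refl)
  ... | no _     | no _     = refl

  private
    successor-distinct : ∀ {m n : ℕ} → suc m ≡ n → m ≢ n
    successor-distinct refl m≡1+m = <-irrefl m≡1+m (n<1+n _)

  tabulate-transferˡ : ∀ {n} (w : Weight n) {a b} → suc (toℕ a) ≡ toℕ b → ∀ X {Y} →
    tabulate w ≡ X ++ w a ∷ w b ∷ Y → length X ≡ toℕ a → tabulate (transfer w a b) ≡ X ++ (w a + w b) ∷ 0 ∷ Y
  tabulate-transferˡ w {a} {b} adj X e len =
    trans (tabulate-update₂ w (transfer w a b) adj (transfer-other w a b) X e len)
          (cong₂ (λ s t → X ++ s ∷ t ∷ _) (transfer-acquirer w a b) (transfer-acquired w a b (successor-distinct adj)))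

  tabulate-transferʳ : ∀ {n} (w : Weight n) {a b} → suc (toℕ a) ≡ toℕ b → ∀ X {Y} →
    tabulate w ≡ X ++ w a ∷ w b ∷ Y → length X ≡ toℕ a → tabulate (transfer w b a) ≡ X ++ 0 ∷ (w b + w a) ∷ Y
  tabulate-transferʳ w {a} {b} adj X e len =
    trans (tabulate-update₂ w (transfer w b a) adj (λ z z≢a z≢b → transfer-other w b a z z≢b z≢a) X e len)
          (cong₂ (λ s t → X ++ s ∷ t ∷ _) (transfer-acquired w b a (successor-distinct adj ∘ sym))
                                          (transfer-acquirer w b a))

  Reach⇒⇝ : ∀ {n} {w w′ : Weight n} → Reach w w′ → tabulate w ⇝ tabulate w′
  Reach⇒⇝ stop = done
  Reach⇒⇝ {w = w} (move u v (inj₁ adj , v≤u , v>0) r) with adjacent-split w adj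
  ... | X , Y , e , len = step X Y e (mergeˡ v≤u v>0) (subst (_⇝ _) (tabulate-transferˡ w adj X e len) (Reach⇒⇝ r))
  Reach⇒⇝ {w = w} (move u v (inj₂ adj , v≤u , v>0) r) with adjacent-split w adj
  ... | X , Y , e , len = step X Y e (mergeʳ v≤u v>0) (subst (_⇝ _) (tabulate-transferʳ w adj X e len) (Reach⇒⇝ r))

  ⇝⇒Reach : ∀ {n} {L T} → L ⇝ T → (w : Weight n) → tabulate w ≡ L →
            ∃ λ w′ → Reach w w′ × tabulate w′ ≡ T
  ⇝⇒Reach done w e = w , stop , e
  ⇝⇒Reach (step X Y refl (mergeˡ y≤x y>0) r) w e with adjacent-entries w X e
  ... | a , b , adj , len , refl , refl with ⇝⇒Reach r (transfer w a b) (tabulate-transferˡ w adj X e len)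
  ...   | w′ , reach , e′ = w′ , move a b (inj₁ adj , y≤x , y>0) reach , e′
  ⇝⇒Reach (step X Y refl (mergeʳ x≤y x>0) r) w e with adjacent-entries w X e
  ... | a , b , adj , len , refl , refl with ⇝⇒Reach r (transfer w b a) (tabulate-transferʳ w adj X e len)
  ...   | w′ , reach , e′ = w′ , move b a (inj₂ adj , x≤y , x>0) reach , e′

  Reach-trans : ∀ {n} {w w′ w″ : Weight n} → Reach w w′ → Reach w′ w″ → Reach w w″
  Reach-trans stop r = r
  Reach-trans (move u v legal r) r′ = move u v legal (Reach-trans r r′)

  residual≡occupied : ∀ {n} (w : Weight n) → residual w ≡ occupied (tabulate w)
  residual≡occupied w = go id w
    where
    go : ∀ {n m} (h : Fin n → Fin m) (w : Fin m → ℕ) →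
         Vec.count (λ v → 0 <? w v) (Vec.tabulate h) ≡ occupied (tabulate (w ∘ h))
    go {zero}  h w = refl
    go {suc n} h w with w (h zero) | go (h ∘ suc) w
    ... | zero  | ih = ih
    ... | suc _ | ih = cong suc ih

  chipWeight-added : ∀ {n x} (i : Fin n) (p : Vec (Fin n) x) → chipWeight (i ∷ p) i ≡ suc (chipWeight p i)
  chipWeight-added i p with i ≟ i
  ... | yes _   = refl
  ... | no i≢i = ⊥-elim (i≢i refl)

  chipWeight-other : ∀ {n x} (i : Fin n) (p : Vec (Fin n) x) z → toℕ z ≢ toℕ i → chipWeight p z ≡ chipWeight (i ∷ p) z
  chipWeight-other i p z z≢i with i ≟ z
  ... | yes refl = ⊥-elim (z≢i refl)
  ... | no _     = refl

  module _ (Aₜ : (n : ℕ) → Weight n → ℕ) (isAₜ : ∀ n (w : Weight n) → IsTotalAcq w (Aₜ n w)) where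

    Aₜ-perturb : ∀ {n a a′} (w w′ : Weight n) → PartPerturbation a a′ → ∀ X Y →
                 tabulate w ≡ X ++ a ∷ Y → tabulate w′ ≡ X ++ a′ ∷ Y → Aₜ n w′ ≤ suc (Aₜ n w)
    Aₜ-perturb {n} w w′ change X Y e e′ with proj₁ (isAₜ n w)
    ... | t , w↠t , _ , residual≡ with ⇝-perturb change X Y e (Reach⇒⇝ w↠t)
    ... | T′ , r′ , occupied≤ with ⇝⇒Reach r′ w′ e′
    ... | t′ , w′↠t′ , refl with proj₁ (isAₜ n t′)
    ... | t″ , t′↠t″ , terminal , _ = begin
      Aₜ n w′                    ≤⟨ proj₂ (isAₜ n w′) t″ (Reach-trans w′↠t′ t′↠t″) terminal ⟩
      residual t″                ≡⟨ residual≡occupied t″ ⟩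
      occupied (tabulate t″)     ≤⟨ occupied-⇝ (Reach⇒⇝ t′↠t″) ⟩
      occupied (tabulate t′)     ≤⟨ occupied≤ ⟩
      suc (occupied (tabulate t)) ≡⟨ cong suc (trans (sym (residual≡occupied t)) residual≡) ⟩
      suc (Aₜ n w)               ∎
      where open ≤-Reasoning

    Aₜ-chip : ∀ {n x} (i : Fin n) (p : Vec (Fin n) x) →
              Aₜ n (chipWeight (i ∷ p)) ≤ suc (Aₜ n (chipWeight p)) ×
              Aₜ n (chipWeight p) ≤ suc (Aₜ n (chipWeight (i ∷ p)))
    Aₜ-chip i p with tabulate-update₁ (chipWeight p) (chipWeight (i ∷ p)) i (chipWeight-other i p)
    ... | X , Y , e , e′ =
      Aₜ-perturb _ _ (add-chip _) X Y e e″ , Aₜ-perturb _ _ (remove-chip _) X Y e″ e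
      where
      e″ = trans e′ (cong (λ k → X ++ k ∷ Y) (chipWeight-added i p))

module PlacementSums where

  open import Data.Nat using (ℕ; zero; suc; _+_; _*_; _^_; _≤_; z≤n)
  open import Data.Nat.Properties
  open import Algebra.Properties.CommutativeSemigroup +-commutativeSemigroup using (interchange)
  open import Data.Fin using (Fin)
  open import Data.Vec using (Vec; _∷_)
  open import Data.List using (List; []; _∷_; length; map; concatMap; allFin)
  open import Data.List.Properties using (map-++; map-cong; map-∘; length-++; length-map; length-tabulate)
  open import Data.Nat.ListAction using (sum)
  open import Data.Nat.ListAction.Properties using (sum-++)
  open import Data.Product using (_×_; proj₁; proj₂)
  open import Relation.Binary.PropositionalEquality
    using (_≡_; refl; sym; trans; cong; cong₂; subst; module ≡-Reasoning)

  module _ {A : Set} where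

    sum-map-mono : ∀ {f g : A → ℕ} → (∀ a → f a ≤ g a) → ∀ xs → sum (map f xs) ≤ sum (map g xs)
    sum-map-mono f≤g []       = z≤n
    sum-map-mono f≤g (x ∷ xs) = +-mono-≤ (f≤g x) (sum-map-mono f≤g xs)

    sum-map-+ : ∀ (f g : A → ℕ) xs → sum (map (λ a → f a + g a) xs) ≡ sum (map f xs) + sum (map g xs)
    sum-map-+ f g []       = refl
    sum-map-+ f g (x ∷ xs) =
      trans (cong (f x + g x +_) (sum-map-+ f g xs)) (interchange (f x) (g x) _ _)

    sum-map-const : ∀ k (xs : List A) → sum (map (λ _ → k) xs) ≡ length xs * k
    sum-map-const k []       = refl
    sum-map-const k (x ∷ xs) = cong (k +_) (sum-map-const k xs)

    sum-map-*ˡ : ∀ k (f : A → ℕ) xs → sum (map (λ a → k * f a) xs) ≡ k * sum (map f xs)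
    sum-map-*ˡ k f []       = sym (*-zeroʳ k)
    sum-map-*ˡ k f (x ∷ xs) = trans (cong (k * f x +_) (sum-map-*ˡ k f xs)) (sym (*-distribˡ-+ k (f x) _))

  sum-map-concatMap : ∀ {A B : Set} (f : B → ℕ) (g : A → List B) xs →
                      sum (map f (concatMap g xs)) ≡ sum (map (λ a → sum (map f (g a))) xs)
  sum-map-concatMap f g []       = refl
  sum-map-concatMap f g (x ∷ xs) =
    trans (cong sum (map-++ f (g x) (concatMap g xs)))
          (trans (sum-++ (map f (g x)) _) (cong (sum (map f (g x)) +_) (sum-map-concatMap f g xs)))

  module ChipSums (n : ℕ) (G : ∀ {x} → Vec (Fin n) x → ℕ)
    (G-chip : ∀ {x} (i : Fin n) (p : Vec (Fin n) x) → G (i ∷ p) ≤ suc (G p) × G p ≤ suc (G (i ∷ p))) where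

    total : ℕ → ℕ
    total x = sum (map G (placements n x))

    private
      extensions : ∀ {x} → Vec (Fin n) x → List (Vec (Fin n) (suc x))
      extensions p = map (_∷ p) (allFin n)

      sumExtensions : ∀ {x} → Vec (Fin n) x → ℕ
      sumExtensions p = sum (map (λ i → G (i ∷ p)) (allFin n))

      length-allFin : length (allFin n) ≡ n
      length-allFin = length-tabulate (λ i → i)

    length-placements : ∀ x → length (placements n x) ≡ n ^ x
    length-placements zero    = refl
    length-placements (suc x) = trans (length-concat (placements n x)) (cong (n *_) (length-placements x))
      where
      length-concat : ∀ ps → length (concatMap extensions ps) ≡ n * length ps
      length-concat []       = sym (*-zeroʳ n)
      length-concat (p ∷ ps) =
        trans (length-++ (extensions p)) (trans (cong₂ _+_ (trans (length-map _ (allFin n)) length-allFin) (length-concat ps))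
              (sym (*-suc n (length ps))))

    total-suc : ∀ x → total (suc x) ≡ sum (map sumExtensions (placements n x))
    total-suc x = trans (sum-map-concatMap G extensions (placements n x))
                        (cong sum (map-cong (λ p → cong sum (sym (map-∘ (allFin n)))) (placements n x)))

    private
      sumExtensions-≤ : ∀ {x} (p : Vec (Fin n) x) → sumExtensions p ≤ n * G p + n
      sumExtensions-≤ p = begin
        sumExtensions p                          ≤⟨ sum-map-mono (λ i → proj₁ (G-chip i p)) (allFin n) ⟩
        sum (map (λ _ → suc (G p)) (allFin n))   ≡⟨ sum-map-const (suc (G p)) (allFin n) ⟩
        length (allFin n) * suc (G p)            ≡⟨ cong (_* suc (G p)) length-allFin ⟩
        n * suc (G p)                            ≡⟨ trans (*-suc n (G p)) (+-comm n (n * G p)) ⟩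
        n * G p + n                              ∎
        where open ≤-Reasoning

      *-≤-sumExtensions : ∀ {x} (p : Vec (Fin n) x) → n * G p ≤ sumExtensions p + n
      *-≤-sumExtensions p = begin
        n * G p                                          ≡⟨ cong (_* G p) length-allFin ⟨
        length (allFin n) * G p                          ≡⟨ sum-map-const (G p) (allFin n) ⟨
        sum (map (λ _ → G p) (allFin n))
          ≤⟨ sum-map-mono (λ i → subst (G p ≤_) (+-comm 1 (G (i ∷ p))) (proj₂ (G-chip i p))) (allFin n) ⟩
        sum (map (λ i → G (i ∷ p) + 1) (allFin n))       ≡⟨ sum-map-+ (λ i → G (i ∷ p)) (λ _ → 1) (allFin n) ⟩
        sumExtensions p + sum (map (λ _ → 1) (allFin n))
          ≡⟨ cong (sumExtensions p +_) (trans (sum-map-const 1 (allFin n)) (trans (*-identityʳ _) length-allFin)) ⟩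
        sumExtensions p + n                              ∎
        where open ≤-Reasoning

      count-placements : ∀ x → sum (map (λ _ → n) (placements n x)) ≡ n ^ suc x
      count-placements x = trans (sum-map-const n (placements n x)) (trans (cong (_* n) (length-placements x)) (*-comm (n ^ x) n))

    total-suc-≤ : ∀ x → total (suc x) ≤ n * total x + n ^ suc x
    total-suc-≤ x = begin
      total (suc x)                                         ≡⟨ total-suc x ⟩
      sum (map sumExtensions (placements n x))              ≤⟨ sum-map-mono sumExtensions-≤ (placements n x) ⟩
      sum (map (λ p → n * G p + n) (placements n x))        ≡⟨ sum-map-+ (λ p → n * G p) (λ _ → n) (placements n x) ⟩
      sum (map (λ p → n * G p) (placements n x)) + sum (map (λ _ → n) (placements n x))
        ≡⟨ cong₂ _+_ (sum-map-*ˡ n G (placements n x)) (count-placements x) ⟩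
      n * total x + n ^ suc x                               ∎
      where open ≤-Reasoning

    *-total-≤ : ∀ x → n * total x ≤ total (suc x) + n ^ suc x
    *-total-≤ x = begin
      n * total x                                           ≡⟨ sum-map-*ˡ n G (placements n x) ⟨
      sum (map (λ p → n * G p) (placements n x))            ≤⟨ sum-map-mono *-≤-sumExtensions (placements n x) ⟩
      sum (map (λ p → sumExtensions p + n) (placements n x)) ≡⟨ sum-map-+ sumExtensions (λ _ → n) (placements n x) ⟩
      sum (map sumExtensions (placements n x)) + sum (map (λ _ → n) (placements n x))
        ≡⟨ cong₂ _+_ (sym (total-suc x)) (count-placements x) ⟩
      total (suc x) + n ^ suc x                             ∎
      where open ≤-Reasoning

module Expectation where

  open import Data.Nat as ℕ using (ℕ; zero; suc)
  import Data.Nat.Properties as ℕ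
  open import Data.Fin using (Fin)
  open import Data.Vec using (Vec; _∷_)
  open import Data.Product using (_×_)
  open import Data.Integer as ℤ using (+_; +≤+)
  import Data.Integer.Properties as ℤ
  open import Data.Rational using (ℚ; _/_; _≤_; _+_; _-_; _*_; -_; 0ℚ; 1ℚ; nonNegative)
  open import Data.Rational.Properties
  import Data.Rational.Unnormalised as ℚᵘ
  import Data.Rational.Unnormalised.Properties as ℚᵘ
  open import Data.Sum using (inj₁; inj₂)
  open import Relation.Binary.PropositionalEquality
    using (_≡_; refl; sym; trans; cong; subst; subst₂; module ≡-Reasoning)
  open PlacementSums using (module ChipSums)

  /-cancelˡ : ∀ k a d → + (suc k ℕ.* a) / (suc k ℕ.* suc d) ≡ + a / suc d
  /-cancelˡ k a d = trans (/-cong (ℤ.pos-* (suc k) a) refl) (fromℚᵘ-cong (ℚᵘ.*-cancelˡ-/ (suc k) {+ a} {suc d}))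

  /-monoˡ-≤ : ∀ {a b} d → a ℕ.≤ b → + a / suc d ≤ + b / suc d
  /-monoˡ-≤ {a} {b} d a≤b = toℚᵘ-cancel-≤
    (ℚᵘ.≤-respˡ-≃ (ℚᵘ.≃-sym (toℚᵘ-fromℚᵘ (ℚᵘ.mkℚᵘ (+ a) d)))
    (ℚᵘ.≤-respʳ-≃ (ℚᵘ.≃-sym (toℚᵘ-fromℚᵘ (ℚᵘ.mkℚᵘ (+ b) d)))
    (ℚᵘ.*≤* (subst₂ ℤ._≤_ (ℤ.pos-* a (suc d)) (ℤ.pos-* b (suc d)) (+≤+ (ℕ.*-monoˡ-≤ (suc d) a≤b))))))

  /-distrib-+ : ∀ a b d → + a / suc d + + b / suc d ≡ + (a ℕ.+ b) / suc d
  /-distrib-+ a b d = toℚᵘ-injective (ℚᵘ.≃-trans (toℚᵘ-homo-+ (+ a / suc d) (+ b / suc d))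
    (ℚᵘ.≃-trans (ℚᵘ.+-cong (toℚᵘ-fromℚᵘ (ℚᵘ.mkℚᵘ (+ a) d)) (toℚᵘ-fromℚᵘ (ℚᵘ.mkℚᵘ (+ b) d)))
    (ℚᵘ.≃-trans (ℚᵘ.*≡* numerator)
    (ℚᵘ.≃-sym (toℚᵘ-fromℚᵘ (ℚᵘ.mkℚᵘ (+ (a ℕ.+ b)) d))))))
    where
    D = suc d
    numerator : (+ a ℤ.* + D ℤ.+ + b ℤ.* + D) ℤ.* + D ≡ + (a ℕ.+ b) ℤ.* + (D ℕ.* D)
    numerator = begin
      (+ a ℤ.* + D ℤ.+ + b ℤ.* + D) ℤ.* + D ≡⟨ cong (ℤ._* + D) (sym (ℤ.*-distribʳ-+ (+ D) (+ a) (+ b))) ⟩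
      (+ (a ℕ.+ b)) ℤ.* + D ℤ.* + D          ≡⟨ ℤ.*-assoc (+ (a ℕ.+ b)) (+ D) (+ D) ⟩
      + (a ℕ.+ b) ℤ.* (+ D ℤ.* + D)          ≡⟨ cong (+ (a ℕ.+ b) ℤ.*_) (sym (ℤ.pos-* D D)) ⟩
      + (a ℕ.+ b) ℤ.* + (D ℕ.* D)            ∎
      where open ≡-Reasoning

  n/n≡1 : ∀ d → + suc d / suc d ≡ 1ℚ
  n/n≡1 d = trans (/-cong (cong +_ (sym (ℕ.*-identityʳ (suc d)))) (sym (ℕ.*-identityʳ (suc d)))) (/-cancelˡ d 1 0)

  ≤+denominator : ∀ {a b} d → a ℕ.≤ b ℕ.+ suc d → + a / suc d ≤ + b / suc d + 1ℚ
  ≤+denominator {a} {b} d a≤b+D = begin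
    + a / suc d                    ≤⟨ /-monoˡ-≤ d a≤b+D ⟩
    + (b ℕ.+ suc d) / suc d        ≡⟨ sym (/-distrib-+ b (suc d) d) ⟩
    + b / suc d + + suc d / suc d  ≡⟨ cong (λ q → + b / suc d + q) (n/n≡1 d) ⟩
    + b / suc d + 1ℚ               ∎
    where open ≤-Reasoning

  module _ where
    open import Data.Rational.Solver using (module +-*-Solver)
    open +-*-Solver

    sub-≤ : ∀ {a b c} → a ≤ b + c → a - b ≤ c
    sub-≤ {a} {b} {c} a≤b+c = ≤-trans (+-monoˡ-≤ (- b) a≤b+c)
      (≤-reflexive (solve 2 (λ b c → (b :+ c) :- b := c) refl b c))

    neg-≤-sub : ∀ {a b c} → b ≤ a + c → - c ≤ a - b
    neg-≤-sub {a} {b} {c} b≤a+c = ≤-trans (≤-reflexive (solve 2 (λ a c → :- c := a :- (a :+ c)) refl a c))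
      (+-monoʳ-≤ a (neg-antimono-≤ b≤a+c))

    sub-+-cancel : ∀ a b → (a + b) - b ≡ a
    sub-+-cancel = solve 2 (λ a b → (a :+ b) :- b := a) refl

    square-swap : ∀ a b → (a - b) * (a - b) ≡ (b - a) * (b - a)
    square-swap = solve 2 (λ a b → (a :- b) :* (a :- b) := (b :- a) :* (b :- a)) refl

    neg-involutive : ∀ a → - (- a) ≡ a
    neg-involutive = solve 1 (λ a → :- (:- a) := a) refl

    neg-square : ∀ a → (- a) * (- a) ≡ a * a
    neg-square = solve 1 (λ a → (:- a) :* (:- a) := a :* a) refl

  nonNeg-square-≤ : ∀ {e c} → 0ℚ ≤ e → e ≤ c → e * e ≤ c * c
  nonNeg-square-≤ {e} {c} 0≤e e≤c = ≤-trans (*-monoʳ-≤-nonNeg e {{nonNegative 0≤e}} e≤c)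
                                          (*-monoˡ-≤-nonNeg c {{nonNegative (≤-trans 0≤e e≤c)}} e≤c)

  square-≤ : ∀ {e c} → - c ≤ e → e ≤ c → e * e ≤ c * c
  square-≤ {e} {c} -c≤e e≤c with ≤-total 0ℚ e
  ... | inj₁ 0≤e = nonNeg-square-≤ 0≤e e≤c
  ... | inj₂ e≤0 = subst (_≤ c * c) (neg-square e)
    (nonNeg-square-≤ (neg-antimono-≤ e≤0) (subst (- e ≤_) (neg-involutive c) (neg-antimono-≤ -c≤e)))

  module OneLipschitz (f : ℕ → ℚ) (f-suc-≤ : ∀ x → f (suc x) ≤ f x + 1ℚ)
                      (f-≤-suc : ∀ x → f x ≤ f (suc x) + 1ℚ) where

    suc-/1 : ∀ k → 1ℚ + + k / 1 ≡ + suc k / 1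
    suc-/1 k = /-distrib-+ 1 k 0

    drift-up : ∀ k y → f (k ℕ.+ y) ≤ f y + + k / 1
    drift-up zero    y = ≤-reflexive (sym (+-identityʳ (f y)))
    drift-up (suc k) y = begin
      f (suc (k ℕ.+ y))          ≤⟨ f-suc-≤ (k ℕ.+ y) ⟩
      f (k ℕ.+ y) + 1ℚ           ≤⟨ +-monoˡ-≤ 1ℚ (drift-up k y) ⟩
      f y + + k / 1 + 1ℚ         ≡⟨ +-assoc (f y) (+ k / 1) 1ℚ ⟩
      f y + (+ k / 1 + 1ℚ)       ≡⟨ cong (λ q → f y + q) (trans (+-comm (+ k / 1) 1ℚ) (suc-/1 k)) ⟩
      f y + + suc k / 1          ∎
      where open ≤-Reasoning

    drift-down : ∀ k y → f y ≤ f (k ℕ.+ y) + + k / 1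
    drift-down zero    y = ≤-reflexive (sym (+-identityʳ (f y)))
    drift-down (suc k) y = begin
      f y                               ≤⟨ drift-down k y ⟩
      f (k ℕ.+ y) + + k / 1             ≤⟨ +-monoˡ-≤ (+ k / 1) (f-≤-suc (k ℕ.+ y)) ⟩
      f (suc (k ℕ.+ y)) + 1ℚ + + k / 1  ≡⟨ +-assoc (f (suc (k ℕ.+ y))) 1ℚ (+ k / 1) ⟩
      f (suc (k ℕ.+ y)) + (1ℚ + + k / 1) ≡⟨ cong (λ q → f (suc (k ℕ.+ y)) + q) (suc-/1 k) ⟩
      f (suc k ℕ.+ y) + + suc k / 1     ∎
      where open ≤-Reasoning

    private
      ordered : ∀ k y → (f (k ℕ.+ y) - f y) * (f (k ℕ.+ y) - f y)
                        ≤ (+ (k ℕ.+ y) / 1 - + y / 1) * (+ (k ℕ.+ y) / 1 - + y / 1)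
      ordered k y = subst (λ d → (f (k ℕ.+ y) - f y) * (f (k ℕ.+ y) - f y) ≤ d * d) (sym difference)
                          (square-≤ {f (k ℕ.+ y) - f y} {+ k / 1} (neg-≤-sub {f (k ℕ.+ y)} (drift-down k y))
                                                                  (sub-≤ {f (k ℕ.+ y)} (drift-up k y)))
        where
        difference : + (k ℕ.+ y) / 1 - + y / 1 ≡ + k / 1
        difference = trans (cong (_- + y / 1) (sym (/-distrib-+ k y 0))) (sub-+-cancel (+ k / 1) (+ y / 1))

    distance² : ∀ x y → (f x - f y) * (f x - f y) ≤ (+ x / 1 - + y / 1) * (+ x / 1 - + y / 1)
    distance² x y with ℕ.≤-total y x
    ... | inj₁ y≤x = subst (λ z → (f z - f y) * (f z - f y) ≤ (+ z / 1 - + y / 1) * (+ z / 1 - + y / 1))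
                           (ℕ.m∸n+n≡m y≤x) (ordered (x ℕ.∸ y) y)
    ... | inj₂ x≤y = subst (λ z → (f x - f z) * (f x - f z) ≤ (+ x / 1 - + z / 1) * (+ x / 1 - + z / 1))
                           (ℕ.m∸n+n≡m x≤y)
                           (subst₂ _≤_ (square-swap (f (k ℕ.+ x)) (f x)) (square-swap (+ (k ℕ.+ x) / 1) (+ x / 1))
                                       (ordered k x))
      where k = y ℕ.∸ x

  module Expected (m : ℕ) (G : ∀ {x} → Vec (Fin (suc m)) x → ℕ)
    (G-chip : ∀ {x} (i : Fin (suc m)) (p : Vec (Fin (suc m)) x) →
              G (i ∷ p) ℕ.≤ suc (G p) × G p ℕ.≤ suc (G (i ∷ p))) where

    open ChipSums (suc m) G G-chip

    expected : ℕ → ℚ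
    expected x = + total x / (suc m ℕ.^ x)
      where instance _ = ℕ.m^n≢0 (suc m) x

    private
      n = suc m

      d : ℕ → ℕ
      d x = ℕ.pred (n ℕ.^ x)

      suc-d : ∀ x → suc (d x) ≡ n ℕ.^ x
      suc-d x = ℕ.suc-pred (n ℕ.^ x) {{ℕ.m^n≢0 n x}}

      expected-rescaled : ∀ x → expected x ≡ + (n ℕ.* total x) / (n ℕ.* suc (d x))
      expected-rescaled x = trans (/-cong {+ total x} {n ℕ.^ x} {+ total x} {suc (d x)} refl (sym (suc-d x)))
                                  (sym (/-cancelˡ m (total x) (d x)))
        where instance _ = ℕ.m^n≢0 n x

      expected-suc : ∀ x → expected (suc x) ≡ + total (suc x) / (n ℕ.* suc (d x))
      expected-suc x = /-cong {+ total (suc x)} {n ℕ.^ suc x} {+ total (suc x)} {n ℕ.* suc (d x)}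
                              refl (cong (n ℕ.*_) (sym (suc-d x)))
        where instance _ = ℕ.m^n≢0 n (suc x)

    expected-suc-≤ : ∀ x → expected (suc x) ≤ expected x + 1ℚ
    expected-suc-≤ x = begin
      expected (suc x)                         ≡⟨ expected-suc x ⟩
      + total (suc x) / (n ℕ.* suc (d x))      ≤⟨ ≤+denominator _ bound ⟩
      + (n ℕ.* total x) / (n ℕ.* suc (d x)) + 1ℚ ≡⟨ cong (_+ 1ℚ) (sym (expected-rescaled x)) ⟩
      expected x + 1ℚ                          ∎
      where
      open ≤-Reasoning
      bound : total (suc x) ℕ.≤ n ℕ.* total x ℕ.+ n ℕ.* suc (d x)
      bound = subst (λ D → total (suc x) ℕ.≤ n ℕ.* total x ℕ.+ n ℕ.* D) (sym (suc-d x)) (total-suc-≤ x)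

    expected-≤-suc : ∀ x → expected x ≤ expected (suc x) + 1ℚ
    expected-≤-suc x = begin
      expected x                               ≡⟨ expected-rescaled x ⟩
      + (n ℕ.* total x) / (n ℕ.* suc (d x))    ≤⟨ ≤+denominator _ bound ⟩
      + total (suc x) / (n ℕ.* suc (d x)) + 1ℚ ≡⟨ cong (_+ 1ℚ) (sym (expected-suc x)) ⟩
      expected (suc x) + 1ℚ                    ∎
      where
      open ≤-Reasoning
      bound : n ℕ.* total x ℕ.≤ total (suc x) ℕ.+ n ℕ.* suc (d x)
      bound = subst (λ D → n ℕ.* total x ℕ.≤ total (suc x) ℕ.+ n ℕ.* D) (sym (suc-d x)) (*-total-≤ x)

open import Data.Nat using (ℕ; NonZero; _≥_)
open import Data.Product using (∃)
open import Data.Integer using (+_)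
open import Data.Rational using (ℚ; _≤_; _*_; _-_; 0ℚ; _/_)
open import Data.Nat using (zero; suc; ≢-nonZero⁻¹)
open import Data.Rational.Properties using (≤-trans)
open import Data.Empty using (⊥-elim)
open import Relation.Binary.PropositionalEquality using (refl)
open PathAcquisition using (Aₜ-chip)
open Expectation using (module Expected; module OneLipschitz)

lemma3p6 : (Aₜ : (n : ℕ) → Weight n → ℕ)
    → (∀ n (w : Weight n) → IsTotalAcq w (Aₜ n w))
    → (φ : ℕ → ℚ)
    → (∀ (M : ℚ) → ∃ λ N → ∀ n → n ≥ N → M ≤ φ n)
    → ∀ (n : ℕ) .{{_ : NonZero n}} (x : ℕ)
    → 0ℚ ≤ φ n
    → ((+ x / 1) - (+ n / 1)) * ((+ x / 1) - (+ n / 1)) ≤ φ n * φ n * (+ n / 1)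
    → (E n x (Aₜ n) - E n n (Aₜ n)) * (E n x (Aₜ n) - E n n (Aₜ n)) ≤ φ n * φ n * (+ n / 1)
lemma3p6 Aₜ isAₜ φ _ zero {{zero≢0}} x _ _ = ⊥-elim (≢-nonZero⁻¹ 0 {{zero≢0}} refl)
lemma3p6 Aₜ isAₜ φ _ (suc m) x _ x-close = ≤-trans (distance² x (suc m)) x-close
  where
  open Expected m (λ p → Aₜ (suc m) (chipWeight p)) (Aₜ-chip Aₜ isAₜ)
  open OneLipschitz expected expected-suc-≤ expected-≤-suc
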